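{- Fix a finite alphabet $\Sigma$ with a total order on it. The set of code words $B(\mathcal{G})$, where $\mathcal{G}$ ranges over all TSLPs in normal form over $\Sigma$, is a prefix code.
   Context: A TSLP in normal form is $\mathcal{G}=(V,A_0,r)$ with nonterminals $V=\{A_0,\dots,A_{m-1}\}$ ($m\ge1$), each of rank $0$ or $1$ ($V_0,V_1$; $A_0\in V_0$), $x$ a parameter symbol, such that: for $A_i\in V_0$, $r(A_i)=A_j(\alpha)$ with $A_j\in V_1$, $\alpha\in V_0\cup\Sigma$; for $A_i\in V_1$, $r(A_i)$ is $A_j(A_k(x))$ ($A_j,A_k\in V_1$), or $a(\alpha,x)$ or $a(x,\alpha)$ ($a\in\Sigma$, $\alpha\in V_0\cup\Sigma$); the relation "$B$ occurs in $r(A)$" is acyclic; with $\rho(A_i)$ the length-2 word $A_j\alpha$, $A_jA_k$, $a\alpha$, $a\alpha$ respectively and $\rho_\mathcal{G}=\rho(A_0)\cdots\rho(A_{m-1})$, it is required that $\rho_\mathcal{G}=A_1u_1A_2u_2\cdots A_{m-1}u_{m-1}$ with $u_i\in(\Sigma\cup\{A_1,\dots,A_i\})^*$; and the trees/contexts derived from distinct nonterminals are distinct. The single-rule TSLP $A_0\to a$ ($a\in\Sigma$) is also allowed, with $\rho_\mathcal{G}=a$. Let $\omega_\mathcal{G}=u_1\cdots u_{m-1}$. Encoding: let $a_1,\dots,a_\sigma$ be $\Sigma$ in the fixed order. The type of $A_i$ is $0$ if $\rho(A_i)\in V_1(V_0\cup\Sigma)$, $1$ if $\rho(A_i)\in V_1V_1$,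 $2$ if $r(A_i)=a(\alpha,x)$, $3$ if $r(A_i)=a(x,\alpha)$. $B(\mathcal{G})=w_0w_1w_2w_3w_4$ with $w_0=0^{m-1}1$; $w_1$ the concatenation of the 2-bit binary encodings of the types of $A_0,\dots,A_{m-1}$; $w_2=10^{|u_1|}\cdots10^{|u_{m-1}|}$; $w_3=0^{k_1-1}1\cdots0^{k_{m-1}-1}1\,0^{l_1}1\cdots0^{l_\sigma}1$, where $k_i$ and $l_i$ are the numbers of occurrences of $A_i$ and $a_i$ in $\rho_\mathcal{G}$; $w_4$ is the binary representation, padded with leading zeros to length $\lceil\log_2|S|\rceil$, of the index (from $0$) of $\omega_\mathcal{G}$ in the lexicographic enumeration, w.r.t. $a_1<\dots<a_\sigma<A_1<\dots<A_{m-1}$, of the set $S$ of all words with the same number of occurrences of each letter as $\omega_\mathcal{G}$. A set of words is a prefix code if no word in it is a proper prefix of another. -}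

module Defs where

open import Data.Nat using (ℕ; zero; suc; _+_; _∸_; _<ᵇ_; _≡ᵇ_)
open import Data.Nat.DivMod using (_/_; _%_)
open import Data.Nat.Logarithm using (⌈log₂_⌉)
open import Data.Fin using (Fin; zero; suc; toℕ; _≤_) renaming (_≟_ to _≟F_)
open import Data.Bool using (Bool; true; false; if_then_else_)
open import Data.List using (List; []; _∷_; _++_; concat; map; concatMap; allFin; length; filter; replicate)
open import Data.Bool.ListAction using (and)
open import Data.List.Relation.Unary.All using (All)
open import Data.Sum using (_⊎_; inj₁; inj₂)
open import Data.Sum.Properties using (≡-dec)
open import Data.Product using (Σ; ∃; ∃-syntax; _×_; _,_)
open import Data.Empty using (⊥)
open import Relation.Nullary using (¬_)
open import Relation.Binary.PropositionalEquality using (_≡_; _≢_)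
open import Relation.Binary.Construct.Closure.Transitive using (TransClosure)

-- Alphabet: Σ = Fin σ, totally ordered by a_1 < ... < a_σ  (index order).
-- Nonterminals: A_0 , ... , A_{m-1} = Fin m.
-- Symbols (terminals or nonterminals): Sym σ m = Fin σ ⊎ Fin m.

Sym : ℕ → ℕ → Set
Sym σ m = Fin σ ⊎ Fin m

-- Right-hand sides of a TSLP in normal form.
data Rule (σ m : ℕ) : Set where
  app  : Fin m → Sym σ m → Rule σ m       -- A_j(α)          (rank 0)
  comp : Fin m → Fin m → Rule σ m         -- A_j(A_k(x))     (rank 1)
  lft  : Fin σ → Sym σ m → Rule σ m       -- a(α, x)         (rank 1)
  rgt  : Fin σ → Sym σ m → Rule σ m       -- a(x, α)         (rank 1)
  leaf : Fin σ → Rule σ m                 -- a  (only for the single-rule TSLP A_0 → a)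

-- rank of the nonterminal whose right-hand side is the given rule
rank : ∀ {σ m} → Rule σ m → ℕ
rank (app _ _)  = 0
rank (comp _ _) = 1
rank (lft _ _)  = 1
rank (rgt _ _)  = 1
rank (leaf _)   = 0

-- A TSLP with m = suc n nonterminals A_0 … A_n.
record TSLP (σ : ℕ) : Set where
  field
    n    : ℕ
    rule : Fin (suc n) → Rule σ (suc n)
open TSLP public

module _ {σ : ℕ} (G : TSLP σ) where
  private
    m : ℕ
    m = suc (n G)
    r : Fin m → Rule σ m
    r = rule G

  Rank0Sym : Sym σ m → Set
  Rank0Sym (inj₁ _) = ⊤'
    where open import Data.Unit using () renaming (⊤ to ⊤')
  Rank0Sym (inj₂ k) = rank (r k) ≡ 0

  WellRankedRule : Rule σ m → Set
  WellRankedRule (app j α)  = rank (r j) ≡ 1 × Rank0Sym α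
  WellRankedRule (comp j k) = rank (r j) ≡ 1 × rank (r k) ≡ 1
  WellRankedRule (lft _ α)  = Rank0Sym α
  WellRankedRule (rgt _ α)  = Rank0Sym α
  WellRankedRule (leaf _)   = ⊥

  occSym : Sym σ m → List (Fin m)
  occSym (inj₁ _) = []
  occSym (inj₂ k) = k ∷ []

  occ : Rule σ m → List (Fin m)
  occ (app j α)  = j ∷ occSym α
  occ (comp j k) = j ∷ k ∷ []
  occ (lft _ α)  = occSym α
  occ (rgt _ α)  = occSym α
  occ (leaf _)   = []

  Occurs : Fin m → Fin m → Set
  Occurs A B = Data.List.Membership.Propositional._∈_ B (occ (r A))
    where import Data.List.Membership.Propositional

  Acyclic : Set
  Acyclic = ∀ i → ¬ TransClosure Occurs i i

  ρ : Rule σ m → List (Sym σ m)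
  ρ (app j α)  = inj₂ j ∷ α ∷ []
  ρ (comp j k) = inj₂ j ∷ inj₂ k ∷ []
  ρ (lft a α)  = inj₁ a ∷ α ∷ []
  ρ (rgt a α)  = inj₁ a ∷ α ∷ []
  ρ (leaf a)   = inj₁ a ∷ []

  ρG : List (Sym σ m)
  ρG = concatMap (λ i → ρ (r i)) (allFin m)

  data Tree : Set where
    leafT : Fin σ → Tree
    node  : Fin σ → Tree → Tree → Tree

  data Ctx : Set where
    hole : Ctx
    inL  : Fin σ → Ctx → Tree → Ctx
    inR  : Fin σ → Tree → Ctx → Ctx

  plug : Ctx → Tree → Tree
  plug hole        s = s
  plug (inL a c t) s = node a (plug c s) t
  plug (inR a t c) s = node a t (plug c s)

  compose : Ctx → Ctx → Ctx
  compose hole        d = d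
  compose (inL a c t) d = inL a (compose c d) t
  compose (inR a t c) d = inR a t (compose c d)

  data EvT : Fin m → Tree → Set
  data EvC : Fin m → Ctx → Set
  data EvS : Sym σ m → Tree → Set

  data EvS where
    evTerm : ∀ {a} → EvS (inj₁ a) (leafT a)
    evNT   : ∀ {k t} → EvT k t → EvS (inj₂ k) t

  data EvT where
    evApp  : ∀ {i j α c t} → r i ≡ app j α → EvC j c → EvS α t → EvT i (plug c t)
    evLeaf : ∀ {i a} → r i ≡ leaf a → EvT i (leafT a)

  data EvC where
    evComp : ∀ {i j k c d} → r i ≡ comp j k → EvC j c → EvC k d → EvC i (compose c d)
    evLft  : ∀ {i a α t} → r i ≡ lft a α → EvS α t → EvC i (inR a t hole)   -- a(α, x)
    evRgt  : ∀ {i a α t} → r i ≡ rgt a α → EvS α t → EvC i (inL a hole t)   -- a(x, α)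

  DistinctValues : Set
  DistinctValues = ∀ i j → i ≢ j →
    (∀ t → EvT i t → EvT j t → ⊥) × (∀ c → EvC i c → EvC j c → ⊥)

  -- The decomposition ρ_G = A_1 u_1 A_2 u_2 ⋯ A_{m-1} u_{m-1}, u_i ∈ (Σ ∪ {A_1,…,A_i})^*.
  -- Here u : Fin n → List Sym, with  u i  standing for u_{i+1}.
  AllowedIn : Fin (n G) → Sym σ m → Set
  AllowedIn i (inj₁ _)       = ⊤'
    where open import Data.Unit using () renaming (⊤ to ⊤')
  AllowedIn i (inj₂ zero)    = ⊥
  AllowedIn i (inj₂ (suc j)) = j ≤ i

  Decomposition : (Fin (n G) → List (Sym σ m)) → Set
  Decomposition u =
    ρG ≡ concatMap (λ i → inj₂ (suc i) ∷ u i) (allFin (n G))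
    × (∀ i → All (AllowedIn i) (u i))

  IsNormalForm : (Fin (n G) → List (Sym σ m)) → Set
  IsNormalForm u =
      (n G ≡ 0 × ∃[ a ] r zero ≡ leaf a)
    ⊎ ( rank (r zero) ≡ 0
      × (∀ i → WellRankedRule (r i))     -- in particular no rule is a leaf rule
      × Acyclic
      × Decomposition u
      × DistinctValues )

Bits : Set
Bits = List Bool

zeros : ℕ → Bits
zeros k = replicate k false

-- k-bit binary representation (most significant bit first, leading zeros)
toBin : ℕ → ℕ → Bits
toBin zero    v = []
toBin (suc k) v = toBin k (v / 2) ++ ((v % 2 ≡ᵇ 1) ∷ [])

-- 2-bit encoding of the type of a rule
-- (the type of the leaf rule A_0 → a is not defined in the paper; we use 0)
typeBits : ∀ {σ m} → Rule σ m → Bits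
typeBits (app _ _)  = false ∷ false ∷ []
typeBits (comp _ _) = false ∷ true ∷ []
typeBits (lft _ _)  = true ∷ false ∷ []
typeBits (rgt _ _)  = true ∷ true ∷ []
typeBits (leaf _)   = false ∷ false ∷ []

module _ {σ m : ℕ} where
  symEq : (s t : Sym σ m) → Bool
  symEq s t = Relation.Nullary.Decidable.does (≡-dec _≟F_ _≟F_ s t)
    where import Relation.Nullary.Decidable

  count : Sym σ m → List (Sym σ m) → ℕ
  count s w = length (Data.List.filterᵇ (symEq s) w)
    where import Data.List

  -- the order a_1 < … < a_σ < A_0 < A_1 < … < A_{m-1}
  key : Sym σ m → ℕ
  key (inj₁ a) = toℕ a
  key (inj₂ A) = σ + toℕ A

  lexLt : List (Sym σ m) → List (Sym σ m) → Bool
  lexLt []       []       = false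
  lexLt []       (_ ∷ _)  = true
  lexLt (_ ∷ _)  []       = false
  lexLt (x ∷ xs) (y ∷ ys) =
    if key x <ᵇ key y then true
    else if key x ≡ᵇ key y then lexLt xs ys else false

  allSyms : List (Sym σ m)
  allSyms = map inj₁ (allFin σ) ++ map inj₂ (allFin m)

  words : ℕ → List (List (Sym σ m))
  words zero    = [] ∷ []
  words (suc k) = concatMap (λ s → map (s ∷_) (words k)) allSyms

  sameCounts : List (Sym σ m) → List (Sym σ m) → Bool
  sameCounts ω w = and (map (λ s → count s w ≡ᵇ count s ω) allSyms)

  permsOf : List (Sym σ m) → List (List (Sym σ m))
  permsOf ω = Data.List.filterᵇ (sameCounts ω) (words (length ω))
    where import Data.List

  -- index (from 0) of ω in the lexicographic enumeration of S
  lexIndex : List (Sym σ m) → ℕ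
  lexIndex ω = length (Data.List.filterᵇ (λ w → lexLt w ω) (permsOf ω))
    where import Data.List

  w4 : List (Sym σ m) → Bits
  w4 ω = toBin ⌈log₂ length (permsOf ω) ⌉ (lexIndex ω)

module _ {σ : ℕ} (G : TSLP σ) (u : Fin (n G) → List (Sym σ (suc (n G)))) where
  ωG : List (Sym σ (suc (n G)))
  ωG = concat (map u (allFin (n G)))

  B : Bits
  B = w0 ++ w1 ++ w2 ++ w3 ++ w4 ωG
    where
      w0 = zeros (n G) ++ (true ∷ [])
      w1 = concatMap (λ i → typeBits (rule G i)) (allFin (suc (n G)))
      w2 = concatMap (λ i → true ∷ zeros (length (u i))) (allFin (n G))
      w3 = concatMap (λ i → zeros (count (inj₂ (suc i)) (ρG G) ∸ 1) ++ (true ∷ [])) (allFin (n G))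
           ++ concatMap (λ a → zeros (count (inj₁ a) (ρG G)) ++ (true ∷ [])) (allFin σ)

ProperPrefix : Bits → Bits → Set
ProperPrefix x y = Σ Bits λ s → (s ≢ []) × (x ++ s ≡ y)

-- B(G) is decoded from left to right, and every segment turns out to have a length fixed by
-- what was decoded before it.  The unary code w₀ gives m; w₁ has length 2m; w₂ has length
-- |ρ_G| = 2m when m > 1 and is empty when m = 1.  The unary codes of w₃ give the numbers of
-- occurrences of every letter of ρ_G, hence of ω_G (which is ρ_G without the heads A_1 … A_{m-1},
-- and never contains A_0).  These counts determine the set S of rearrangements of ω_G, so also
-- the length ⌈log₂|S|⌉ of w₄.  Hence if B(G) is a prefix of B(H) the two words have equal length.
module Submission where

open import Defs
open import Data.Nat using (ℕ; zero; suc; pred; _+_; _∸_; _≡ᵇ_)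
open import Data.Nat.DivMod using (_/_)
open import Data.Nat.Properties using (+-cancelˡ-≡; +-comm)
open import Data.Nat.Logarithm using (⌈log₂_⌉)
open import Data.Fin using (Fin; zero; suc; _≟_)
open import Data.Fin.Properties using (suc-injective; 0≢1+n)
open import Data.Bool using (Bool; true; false; T)
open import Data.Bool.ListAction using (and)
open import Data.List using (List; []; _∷_; [_]; _++_; map; concatMap; allFin; length; tabulate; filterᵇ)
open import Data.List.Properties
  using ( ++-monoid; ++-assoc; ++-identityʳ; ++-cancelˡ; ∷-injectiveʳ; length-++; length-replicate
        ; map-cong; map-tabulate; filter-++; filter-≐ )
open import Data.List.Relation.Unary.All using (All; []; _∷_)
import Data.List.Relation.Unary.All as All
open import Data.List.Relation.Unary.All.Properties using (concat⁺; map⁺; tabulate⁺; tabulate⁻)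
open import Data.Sum using (inj₁; inj₂)
open import Data.Sum.Properties using (≡-dec; inj₂-injective)
open import Data.Product using (_×_; _,_; proj₁; proj₂; map₁)
open import Data.Empty using (⊥-elim)
open import Function using (_∘_; Injective)
open import Relation.Nullary using (¬_)
open import Relation.Unary using (_≐_)
open import Relation.Nullary.Decidable using (dec-true; dec-false; T?)
open import Relation.Binary.PropositionalEquality hiding ([_])
open import Tactic.MonoidSolver using (solve)
open import Data.Nat.Tactic.RingSolver using (solve-∀)

++-cancel-by-length : ∀ {A : Set} (xs ys : List A) {p q : List A} →
  length xs ≡ length ys → xs ++ p ≡ ys ++ q → p ≡ q
++-cancel-by-length []       []       _ eq = eq
++-cancel-by-length (x ∷ xs) (y ∷ ys) l eq =
  ++-cancel-by-length xs ys (cong pred l) (∷-injectiveʳ eq)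

length-concatMap-cong : ∀ {X A B : Set} (f : X → List A) (g : X → List B) →
  (∀ x → length (f x) ≡ length (g x)) → ∀ xs → length (concatMap f xs) ≡ length (concatMap g xs)
length-concatMap-cong f g eq []       = refl
length-concatMap-cong f g eq (x ∷ xs) = begin
  length (f x ++ concatMap f xs)          ≡⟨ length-++ (f x) ⟩
  length (f x) + length (concatMap f xs)  ≡⟨ cong₂ _+_ (eq x) (length-concatMap-cong f g eq xs) ⟩
  length (g x) + length (concatMap g xs)  ≡⟨ length-++ (g x) ⟨
  length (g x ++ concatMap g xs)          ∎
  where open ≡-Reasoning

unary : ℕ → Bits
unary k = zeros k ++ true ∷ []

unaries : ∀ {X : Set} → (X → ℕ) → List X → Bits
unaries f = concatMap (unary ∘ f)

unary-cancel : ∀ a b {p q : Bits} → unary a ++ p ≡ unary b ++ q → a ≡ b × p ≡ q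
unary-cancel zero    zero    eq = refl , ∷-injectiveʳ eq
unary-cancel (suc a) (suc b) eq = map₁ (cong suc) (unary-cancel a b (∷-injectiveʳ eq))

unaries-cancel : ∀ {X : Set} (f g : X → ℕ) xs {p q : Bits} →
  unaries f xs ++ p ≡ unaries g xs ++ q → All (λ x → f x ≡ g x) xs × p ≡ q
unaries-cancel f g []       eq = [] , eq
unaries-cancel f g (x ∷ xs) {p} {q} eq
  with unary-cancel (f x) (g x)
         (trans (sym (++-assoc (unary (f x)) _ p)) (trans eq (++-assoc (unary (g x)) _ q)))
... | fx≡gx , eq′ = map₁ (fx≡gx ∷_) (unaries-cancel f g xs eq′)

module _ {σ m : ℕ} where
  count-here : ∀ (s : Sym σ m) xs → count s (s ∷ xs) ≡ suc (count s xs)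
  count-here s xs with symEq s s | dec-true (≡-dec _≟_ _≟_ s s) refl
  ... | true | _ = refl

  count-there : ∀ {s x : Sym σ m} xs → s ≢ x → count s (x ∷ xs) ≡ count s xs
  count-there {s} {x} xs s≢x with symEq s x | dec-false (≡-dec _≟_ _≟_ s x) s≢x
  ... | false | _ = refl

  count-++ : ∀ (s : Sym σ m) xs ys → count s (xs ++ ys) ≡ count s xs + count s ys
  count-++ s xs ys =
    trans (cong length (filter-++ (T? ∘ symEq s) xs ys)) (length-++ (filterᵇ (symEq s) xs))

  count-none : ∀ {s : Sym σ m} {xs} → All (s ≢_) xs → count s xs ≡ 0
  count-none []                     = refl
  count-none {xs = _ ∷ xs} (s≢x ∷ ps) = trans (count-there xs s≢x) (count-none ps)

  count-tabulate-injective : ∀ {k} (f : Fin k → Sym σ m) → Injective _≡_ _≡_ f →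
    ∀ i → count (f i) (tabulate f) ≡ 1
  count-tabulate-injective f inj zero = begin
    count (f zero) (f zero ∷ tabulate (f ∘ suc))  ≡⟨ count-here (f zero) _ ⟩
    suc (count (f zero) (tabulate (f ∘ suc)))
      ≡⟨ cong suc (count-none (tabulate⁺ {f = f ∘ suc} (λ _ → 0≢1+n ∘ inj))) ⟩
    1                                             ∎
    where open ≡-Reasoning
  count-tabulate-injective f inj (suc i) =
    trans (count-there (tabulate (f ∘ suc)) (0≢1+n ∘ sym ∘ inj))
          (count-tabulate-injective (f ∘ suc) (suc-injective ∘ inj) i)

module _ {A : Set} (μ : List A → ℕ) (μ-++ : ∀ xs ys → μ (xs ++ ys) ≡ μ xs + μ ys) where
  additive-interleave : ∀ {X : Set} (h : X → A) (f : X → List A) xs →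
    μ (concatMap (λ x → h x ∷ f x) xs) ≡ μ (map h xs) + μ (concatMap f xs)
  additive-interleave h f []       = μ-++ [] []
  additive-interleave h f (x ∷ xs) = begin
    μ (h x ∷ f x ++ R)                      ≡⟨ μ-++ [ h x ] (f x ++ R) ⟩
    μ [ h x ] + μ (f x ++ R)                ≡⟨ cong (μ [ h x ] +_) (μ-++ (f x) R) ⟩
    μ [ h x ] + (μ (f x) + μ R)             ≡⟨ cong (λ r → μ [ h x ] + (μ (f x) + r)) IH ⟩
    μ [ h x ] + (μ (f x) + (μ H + μ C))     ≡⟨ rearrange (μ [ h x ]) (μ (f x)) (μ H) (μ C) ⟩
    (μ [ h x ] + μ H) + (μ (f x) + μ C)     ≡⟨ cong₂ _+_ (μ-++ [ h x ] H) (μ-++ (f x) C) ⟨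
    μ (h x ∷ H) + μ (f x ++ C)              ∎
    where
      open ≡-Reasoning
      R H C : List A
      R = concatMap (λ x → h x ∷ f x) xs
      H = map h xs
      C = concatMap f xs

      IH : μ R ≡ μ H + μ C
      IH = additive-interleave h f xs
      rearrange : ∀ a b c d → a + (b + (c + d)) ≡ (a + c) + (b + d)
      rearrange = solve-∀

module _ {σ : ℕ} where
  w₁ : TSLP σ → Bits
  w₁ G = concatMap (typeBits ∘ rule G) (allFin (suc (n G)))

  w₂ : (G : TSLP σ) → (Fin (n G) → List (Sym σ (suc (n G)))) → Bits
  w₂ G u = concatMap (λ i → true ∷ zeros (length (u i))) (allFin (n G))

  w₃ᴬ w₃ᵃ : TSLP σ → Bits
  w₃ᴬ G = unaries (λ i → count (inj₂ (suc i)) (ρG G) ∸ 1) (allFin (n G))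
  w₃ᵃ G = unaries (λ a → count (inj₁ a) (ρG G)) (allFin σ)

  afterSize : (G : TSLP σ) → (Fin (n G) → List (Sym σ (suc (n G)))) → Bits → Bits
  afterSize G u s = w₁ G ++ w₂ G u ++ w₃ᴬ G ++ w₃ᵃ G ++ w4 (ωG G u) ++ s

  B-++ : ∀ G u s → B G u ++ s ≡ unary (n G) ++ afterSize G u s
  B-++ G u s = reassociate (unary (n G)) (w₁ G) (w₂ G u) (w₃ᴬ G) (w₃ᵃ G) (w4 (ωG G u)) s
    where
      reassociate : ∀ (a b c d e f s : Bits) →
        (a ++ b ++ c ++ (d ++ e) ++ f) ++ s ≡ a ++ b ++ c ++ d ++ e ++ f ++ s
      reassociate a b c d e f s = solve (++-monoid Bool)

headSymbols : ∀ {σ} k → List (Sym σ (suc k))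
headSymbols k = map (inj₂ ∘ suc) (allFin k)

module _ {σ : ℕ} {G : TSLP σ} {u : Fin (n G) → List (Sym σ (suc (n G)))} where
  normal-nonleaf : IsNormalForm G u → n G ≢ 0 →
    (∀ i → WellRankedRule G (rule G i)) × Decomposition G u
  normal-nonleaf (inj₁ (n≡0 , _))              n≢0 = ⊥-elim (n≢0 n≡0)
  normal-nonleaf (inj₂ (_ , wr , _ , dec , _)) _   = wr , dec

  module _ (dec : Decomposition G u) where
    additive-ρG : (μ : List (Sym σ (suc (n G))) → ℕ) →
      (∀ xs ys → μ (xs ++ ys) ≡ μ xs + μ ys) →
      μ (ρG G) ≡ μ (headSymbols (n G)) + μ (ωG G u)
    additive-ρG μ μ-++ =
      trans (cong μ (proj₁ dec)) (additive-interleave μ μ-++ (inj₂ ∘ suc) u (allFin (n G)))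

    length-w₂ : length (w₂ G u) ≡ length (ρG G)
    length-w₂ = trans
      (length-concatMap-cong (λ i → true ∷ zeros (length (u i))) (λ i → inj₂ (suc i) ∷ u i)
        (λ i → cong suc (length-replicate (length (u i)))) (allFin (n G)))
      (sym (cong length (proj₁ dec)))

    count-ω-letter : ∀ a → count (inj₁ a) (ωG G u) ≡ count (inj₁ a) (ρG G)
    count-ω-letter a = sym (trans (additive-ρG (count (inj₁ a)) (count-++ (inj₁ a)))
      (cong (_+ count (inj₁ a) (ωG G u)) no-letter-in-heads))
      where
        no-letter-in-heads : count (inj₁ a) (headSymbols (n G)) ≡ 0
        no-letter-in-heads = count-none {s = inj₁ a} (map⁺ (All.universal (λ _ ()) (allFin (n G))))

    count-ω-A₀ : count (inj₂ zero) (ωG G u) ≡ 0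
    count-ω-A₀ =
      count-none (concat⁺ (map⁺ (tabulate⁺ λ i → All.map (A₀-not-allowed _) (proj₂ dec i))))
      where
        A₀-not-allowed : ∀ {i} t → AllowedIn G i t → inj₂ zero ≢ t
        A₀-not-allowed (inj₂ zero)    ()
        A₀-not-allowed (inj₁ _)       _ ()
        A₀-not-allowed (inj₂ (suc _)) _ ()

    count-ω-nonterminal : ∀ i →
      count (inj₂ (suc i)) (ωG G u) ≡ count (inj₂ (suc i)) (ρG G) ∸ 1
    count-ω-nonterminal i = sym (cong (_∸ 1) (trans (additive-ρG (count A) (count-++ A))
      (cong (_+ count A (ωG G u)) once-in-heads)))
      where
        A : Sym σ (suc (n G))
        A = inj₂ (suc i)
        once-in-heads : count A (headSymbols (n G)) ≡ 1
        once-in-heads = trans (cong (count A) (map-tabulate (λ j → j) (inj₂ ∘ suc)))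
          (count-tabulate-injective (inj₂ ∘ suc) (suc-injective ∘ inj₂-injective) i)

length-toBin : ∀ k v → length (toBin k v) ≡ k
length-toBin zero    v = refl
length-toBin (suc k) v =
  trans (length-++ (toBin k (v / 2))) (trans (cong (_+ 1) (length-toBin k (v / 2))) (+-comm k 1))

module _ {σ m : ℕ} (ω ω′ : List (Sym σ m)) (same-length : length ω ≡ length ω′)
         (same-counts : ∀ t → count t ω ≡ count t ω′) where
  permsOf-cong : permsOf ω ≡ permsOf ω′
  permsOf-cong = begin
    filterᵇ (sameCounts ω) (words (length ω))
      ≡⟨ filter-≐ (T? ∘ sameCounts ω) (T? ∘ sameCounts ω′) equivalent (words (length ω)) ⟩
    filterᵇ (sameCounts ω′) (words (length ω))
      ≡⟨ cong (filterᵇ (sameCounts ω′) ∘ words) same-length ⟩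
    filterᵇ (sameCounts ω′) (words (length ω′))  ∎
    where
      open ≡-Reasoning
      same : ∀ w → sameCounts ω w ≡ sameCounts ω′ w
      same w = cong and (map-cong (λ t → cong (count t w ≡ᵇ_) (same-counts t)) allSyms)
      equivalent : (T ∘ sameCounts ω) ≐ (T ∘ sameCounts ω′)
      equivalent = (λ {w} → subst T (same w)) , (λ {w} → subst T (sym (same w)))

  length-w4-cong : length (w4 ω) ≡ length (w4 ω′)
  length-w4-cong = begin
    length (w4 ω)                        ≡⟨ length-toBin _ (lexIndex ω) ⟩
    ⌈log₂ length (permsOf ω) ⌉           ≡⟨ cong (λ S → ⌈log₂ length S ⌉) permsOf-cong ⟩
    ⌈log₂ length (permsOf ω′) ⌉          ≡⟨ length-toBin _ (lexIndex ω′) ⟨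
    length (w4 ω′)                       ∎
    where open ≡-Reasoning

length-typeBits : ∀ {σ m} (r : Rule σ m) → length (typeBits r) ≡ 2
length-typeBits (app _ _)  = refl
length-typeBits (comp _ _) = refl
length-typeBits (lft _ _)  = refl
length-typeBits (rgt _ _)  = refl
length-typeBits (leaf _)   = refl

length-ρ : ∀ {σ} (G : TSLP σ) r → WellRankedRule G r → length (ρ G r) ≡ 2
length-ρ G (app _ _)  _ = refl
length-ρ G (comp _ _) _ = refl
length-ρ G (lft _ _)  _ = refl
length-ρ G (rgt _ _)  _ = refl

-- Lets two TSLPs share the index type Fin k, so that their codes can be compared segment by segment.
sized : ∀ {σ} k → (Fin (suc k) → Rule σ (suc k)) → TSLP σ
sized k r = record { n = k ; rule = r }

length-w₁-equal : ∀ {σ k} (rG rH : Fin (suc k) → Rule σ (suc k)) →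
  length (w₁ (sized k rG)) ≡ length (w₁ (sized k rH))
length-w₁-equal {k = k} rG rH = length-concatMap-cong (typeBits ∘ rG) (typeBits ∘ rH)
  (λ i → trans (length-typeBits (rG i)) (sym (length-typeBits (rH i)))) (allFin (suc k))

module _ {σ k : ℕ} {rG rH : Fin (suc k) → Rule σ (suc k)} {u v : Fin k → List (Sym σ (suc k))}
         (dG : Decomposition (sized k rG) u) (dH : Decomposition (sized k rH) v) where
  private
    G H : TSLP σ
    G = sized k rG
    H = sized k rH

  ω-length-cong : length (ρG G) ≡ length (ρG H) → length (ωG G u) ≡ length (ωG H v)
  ω-length-cong same-length = +-cancelˡ-≡ (length (headSymbols {σ} k)) _ _ (begin
    length (headSymbols k) + length (ωG G u)  ≡⟨ additive-ρG dG length (λ xs _ → length-++ xs) ⟨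
    length (ρG G)                             ≡⟨ same-length ⟩
    length (ρG H)                             ≡⟨ additive-ρG dH length (λ xs _ → length-++ xs) ⟩
    length (headSymbols k) + length (ωG H v)  ∎)
    where open ≡-Reasoning

  ω-count-cong :
    (∀ i → count (inj₂ (suc i)) (ρG G) ∸ 1 ≡ count (inj₂ (suc i)) (ρG H) ∸ 1) →
    (∀ a → count (inj₁ a) (ρG G) ≡ count (inj₁ a) (ρG H)) →
    ∀ t → count t (ωG G u) ≡ count t (ωG H v)
  ω-count-cong _ same-letters (inj₁ a) =
    trans (count-ω-letter dG a) (trans (same-letters a) (sym (count-ω-letter dH a)))
  ω-count-cong _ _ (inj₂ zero) = trans (count-ω-A₀ dG) (sym (count-ω-A₀ dH))
  ω-count-cong same-nonterminals _ (inj₂ (suc i)) =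
    trans (count-ω-nonterminal dG i) (trans (same-nonterminals i) (sym (count-ω-nonterminal dH i)))

afterSize-prefix-free : ∀ {σ k l}
  (rG : Fin (suc k) → Rule σ (suc k)) (rH : Fin (suc l) → Rule σ (suc l))
  (u : Fin k → List (Sym σ (suc k))) (v : Fin l → List (Sym σ (suc l))) → k ≡ l →
  IsNormalForm (sized k rG) u → IsNormalForm (sized l rH) v →
  ∀ {s} → afterSize (sized k rG) u s ≡ afterSize (sized l rH) v [] → s ≡ []
-- With a single nonterminal, w₂, w₃ᴬ and ω_G are empty.
afterSize-prefix-free {σ} {zero} rG rH u v refl _ _ {s} eq =
  ++-cancelˡ (w4 (ωG G u)) s [] (proj₂ (unaries-cancel _ _ (allFin σ) after-w₁))
  where
    G H : TSLP σ
    G = sized 0 rG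
    H = sized 0 rH

    after-w₁ : w₃ᵃ G ++ w4 (ωG G u) ++ s ≡ w₃ᵃ H ++ w4 (ωG H v) ++ []
    after-w₁ = ++-cancel-by-length (w₁ G) (w₁ H) (length-w₁-equal rG rH) eq
afterSize-prefix-free {σ} {suc k} rG rH u v refl nfG nfH {s} eq
  with normal-nonleaf nfG (λ ()) | normal-nonleaf nfH (λ ())
... | wrG , dG | wrH , dH =
  ++-cancel-by-length (w4 (ωG G u)) (w4 (ωG H v))
    (length-w4-cong (ωG G u) (ωG H v) (ω-length-cong dG dH same-length-ρG)
      (ω-count-cong dG dH (tabulate⁻ {f = λ i → i} (proj₁ nonterminals))
                          (tabulate⁻ {f = λ a → a} (proj₁ letters))))
    (proj₂ letters)
  where
    G H : TSLP σ
    G = sized (suc k) rG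
    H = sized (suc k) rH

    same-length-ρG : length (ρG G) ≡ length (ρG H)
    same-length-ρG = length-concatMap-cong (ρ G ∘ rG) (ρ H ∘ rH)
      (λ i → trans (length-ρ G (rG i) (wrG i)) (sym (length-ρ H (rH i) (wrH i)))) (allFin (suc (suc k)))

    after-w₂ : w₃ᴬ G ++ w₃ᵃ G ++ w4 (ωG G u) ++ s ≡ w₃ᴬ H ++ w₃ᵃ H ++ w4 (ωG H v) ++ []
    after-w₂ =
      ++-cancel-by-length (w₂ G u) (w₂ H v)
        (trans (length-w₂ dG) (trans same-length-ρG (sym (length-w₂ dH))))
        (++-cancel-by-length (w₁ G) (w₁ H) (length-w₁-equal rG rH) eq)

    nonterminals :
      All (λ i → count (inj₂ (suc i)) (ρG G) ∸ 1 ≡ count (inj₂ (suc i)) (ρG H) ∸ 1)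
          (allFin (suc k))
      × w₃ᵃ G ++ w4 (ωG G u) ++ s ≡ w₃ᵃ H ++ w4 (ωG H v) ++ []
    nonterminals = unaries-cancel _ _ (allFin (suc k)) after-w₂

    letters : All (λ a → count (inj₁ a) (ρG G) ≡ count (inj₁ a) (ρG H)) (allFin σ)
            × w4 (ωG G u) ++ s ≡ w4 (ωG H v) ++ []
    letters = unaries-cancel _ _ (allFin σ) (proj₂ nonterminals)

mainTheorem6 : (σ : ℕ) (G H : TSLP σ)
    (u : Fin (n G) → List (Sym σ (suc (n G))))
    (v : Fin (n H) → List (Sym σ (suc (n H)))) →
    IsNormalForm G u → IsNormalForm H v →
    ¬ ProperPrefix (B G u) (B H v)
mainTheorem6 σ G H u v nfG nfH (s , s≢[] , Gs≡H)
  with unary-cancel (n G) (n H)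
         (trans (sym (B-++ G u s)) (trans Gs≡H (trans (sym (++-identityʳ (B H v))) (B-++ H v []))))
... | same-size , same-rest =
  s≢[] (afterSize-prefix-free (rule G) (rule H) u v same-size nfG nfH same-rest)
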